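{- (1) In $\lambda_\rho$: if $\Gamma,x:A\vdash t:B$ and $\Delta\vdash r:A$, then $\Gamma,\Delta\vdash t[r/x]:B$. (2) In $\lambda_\rho^\circ$: if $\Gamma,x:A\Vdash t:B$ and $\Delta\Vdash r:A$, then $\Gamma,\Delta\Vdash t[r/x]:B$.
   Context: Calculus $\lambda_\rho$. Terms: $t::=x\mid\lambda x.t\mid tt\mid\rho^n\mid U^nt\mid\pi^nt\mid t\otimes t\mid(b^m,\rho^n)\mid\mathsf{letcase}\ x=r\ \mathsf{in}\ \{t_0,\dots,t_{2^m-1}\}$ ($m\le n$ naturals; $\rho^n$ a density matrix on $n$ qubits; $0\le b^m<2^m$; $U^n$ a $2^n\times2^n$ unitary; $\pi^n$ the computational-basis measurement on $n$ qubits; $x$ bound in $\lambda x.t$ and in the branches; $t[r/x]$ capture-avoiding substitution). Types $A::=n\mid(m,n)\mid A\multimap A$ ($m\le n$); contexts are finite sets of declarations $x:A$ and $\Gamma,\Delta$ denotes a union with disjoint variables. Typing: $\Gamma,x:A\vdash x:A$; $\Gamma,x:A\vdash t:B\Rightarrow\Gamma\vdash\lambda x.t:A\multimap B$; $\Gamma\vdash t:A\multimap B,\ \Delta\vdash r:A\Rightarrow\Gamma,\Delta\vdash tr:B$; $\Gamma\vdash\rho^n:n$; $\Gamma\vdash t:n\Rightarrow\Gamma\vdash U^mt:n$; $\Gamma\vdash t:n\Rightarrow\Gamma\vdash\pi^mt:(m,n)$; $\Gamma\vdash t:n,\ \Delta\vdash r:m\Rightarrow\Gamma,\Delta\vdash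 t\otimes r:n+m$; $\Gamma\vdash(b^m,\rho^n):(m,n)$; $x:n\vdash t_i:A$ for all $i$ and $\Gamma\vdash r:(m,n)\Rightarrow\Gamma\vdash\mathsf{letcase}\ x=r\ \mathsf{in}\ \{t_0,\dots,t_{2^m-1}\}:A$. Calculus $\lambda_\rho^\circ$: same terms without $(b^m,\rho^n)$, with letcase written $\mathsf{letcase}^\circ$, and with sums $\sum_{i=1}^kp_it_i$ ($p_i\in(0,1]$, $\sum p_i=1$); typing $\Vdash$ has the same rules (without the rule for $(b^m,\rho^n)$) plus: $\Gamma\Vdash t_i:A$ for all $i$ and $\sum_ip_i=1\Rightarrow\Gamma\Vdash\sum_ip_it_i:A$. -}

module Defs where

open import Data.Nat using (ℕ; zero; suc; _≤_; _^_; _+_; _≟_)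
open import Data.Fin using (Fin)
open import Data.List using (List; []; _∷_; map)
open import Data.List.Membership.Propositional using (_∈_; _∉_)
open import Data.List.Relation.Binary.Permutation.Propositional using (_↭_)
open import Data.List.Relation.Unary.Unique.Propositional using (Unique)
open import Data.List using (_++_)
open import Data.Product using (_×_; _,_; proj₁)
open import Relation.Nullary using (yes; no)

-- Uninterpreted annotations carried by terms.  Typing never inspects them
-- (only their dimension indices), so we quantify over arbitrary carriers.
record Annot : Set₁ where
  field
    DM     : ℕ → Set          -- density matrices on n qubits
    Uni    : ℕ → Set          -- 2^n x 2^n unitaries
    Prob   : Set              -- probabilities p ∈ (0,1]
    IsDist : (k : ℕ) → (Fin (suc k) → Prob) → Set   -- p_1 + ... + p_k = 1

Name : Set
Name = ℕ

data Ty : Set where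
  qb   : ℕ → Ty
  cqb  : (m n : ℕ) → m ≤ n → Ty
  _⊸_  : Ty → Ty → Ty

infixr 5 _⊸_

-- contexts: finite sets of declarations x : A, represented as lists whose
-- variables are pairwise distinct; list order is immaterial (rules work up to ↭).
Ctx : Set
Ctx = List (Name × Ty)

Ok : Ctx → Set
Ok Γ = Unique (map proj₁ Γ)

_≅_,,_ : Ctx → Ctx → Ctx → Set
Θ ≅ Γ ,, Δ = Ok Θ × (Θ ↭ (Γ ++ Δ))

-- λρ  (locally nameless: bound variables are de Bruijn indices)

module Lρ (𝔸 : Annot) where
  open Annot 𝔸

  data Term : Set where
    bvar    : ℕ → Term
    fvar    : Name → Term
    lam     : Term → Term
    app     : Term → Term → Term
    dm      : (n : ℕ) → DM n → Term
    U       : (m : ℕ) → Uni m → Term → Term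
    meas    : (m : ℕ) → Term → Term
    _⊗_     : Term → Term → Term
    cval    : (m n : ℕ) → m ≤ n → Fin (2 ^ m) → DM n → Term
    letcase : (m : ℕ) → Term → (Fin (2 ^ m) → Term) → Term  -- letcase x = r in {t_i} (each t_i binds index 0)

  openAt : ℕ → Term → Term → Term
  openAt k u (bvar i) with i ≟ k
  ... | yes _ = u
  ... | no _  = bvar i
  openAt k u (fvar y) = fvar y
  openAt k u (lam t) = lam (openAt (suc k) u t)
  openAt k u (app t s) = app (openAt k u t) (openAt k u s)
  openAt k u (dm n ρ) = dm n ρ
  openAt k u (U m V t) = U m V (openAt k u t)
  openAt k u (meas m t) = meas m (openAt k u t)
  openAt k u (t ⊗ s) = openAt k u t ⊗ openAt k u s
  openAt k u (cval m n p b ρ) = cval m n p b ρ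
  openAt k u (letcase m r ts) = letcase m (openAt k u r) (λ i → openAt (suc k) u (ts i))

  _^^_ : Term → Name → Term
  t ^^ x = openAt 0 (fvar x) t

  -- substitution t[r/x] of r for the free variable x (capture is impossible
  -- in the locally nameless representation)
  _[_/_] : Term → Term → Name → Term
  bvar i [ r / x ] = bvar i
  fvar y [ r / x ] with y ≟ x
  ... | yes _ = r
  ... | no _  = fvar y
  lam t [ r / x ] = lam (t [ r / x ])
  app t s [ r / x ] = app (t [ r / x ]) (s [ r / x ])
  dm n ρ [ r / x ] = dm n ρ
  U m V t [ r / x ] = U m V (t [ r / x ])
  meas m t [ r / x ] = meas m (t [ r / x ])
  (t ⊗ s) [ r / x ] = (t [ r / x ]) ⊗ (s [ r / x ])
  cval m n p b ρ [ r / x ] = cval m n p b ρ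
  letcase m s ts [ r / x ] = letcase m (s [ r / x ]) (λ i → ts i [ r / x ])

  infix 4 _⊢_∶_

  -- binders use cofinite quantification over the fresh name
  data _⊢_∶_ : Ctx → Term → Ty → Set where
    ax   : ∀ {Θ x A} → Ok Θ → (x , A) ∈ Θ → Θ ⊢ fvar x ∶ A
    ⊸i   : ∀ {Γ t A B} (L : List Name) →
           (∀ x → x ∉ L → ((x , A) ∷ Γ) ⊢ t ^^ x ∶ B) →
           Γ ⊢ lam t ∶ A ⊸ B
    ⊸e   : ∀ {Θ Γ Δ t r A B} → Θ ≅ Γ ,, Δ →
           Γ ⊢ t ∶ A ⊸ B → Δ ⊢ r ∶ A → Θ ⊢ app t r ∶ B
    ax-ρ : ∀ {Γ n ρ} → Ok Γ → Γ ⊢ dm n ρ ∶ qb n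
    u    : ∀ {Γ t n m V} → Γ ⊢ t ∶ qb n → Γ ⊢ U m V t ∶ qb n
    π    : ∀ {Γ t n m} (p : m ≤ n) → Γ ⊢ t ∶ qb n → Γ ⊢ meas m t ∶ cqb m n p
    ⊗    : ∀ {Θ Γ Δ t r n m} → Θ ≅ Γ ,, Δ →
           Γ ⊢ t ∶ qb n → Δ ⊢ r ∶ qb m → Θ ⊢ t ⊗ r ∶ qb (n + m)
    ax-b : ∀ {Γ m n p b ρ} → Ok Γ → Γ ⊢ cval m n p b ρ ∶ cqb m n p
    lc   : ∀ {Γ m n p r A} {ts : Fin (2 ^ m) → Term} (L : List Name) →
           (∀ i x → x ∉ L → ((x , qb n) ∷ []) ⊢ ts i ^^ x ∶ A) →
           Γ ⊢ r ∶ cqb m n p → Γ ⊢ letcase m r ts ∶ A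

module Lρ° (𝔸 : Annot) where
  open Annot 𝔸

  data Term : Set where
    bvar     : ℕ → Term
    fvar     : Name → Term
    lam      : Term → Term
    app      : Term → Term → Term
    dm       : (n : ℕ) → DM n → Term
    U        : (m : ℕ) → Uni m → Term → Term
    meas     : (m : ℕ) → Term → Term
    _⊗_      : Term → Term → Term
    letcase° : (m : ℕ) → Term → (Fin (2 ^ m) → Term) → Term
    -- Σ_{i=1}^{k} p_i t_i  (k ≥ 1, indexed by Fin (suc k'))
    psum     : (k : ℕ) → (Fin (suc k) → Prob) → (Fin (suc k) → Term) → Term

  openAt : ℕ → Term → Term → Term
  openAt k u (bvar i) with i ≟ k
  ... | yes _ = u
  ... | no _  = bvar i
  openAt k u (fvar y) = fvar y
  openAt k u (lam t) = lam (openAt (suc k) u t)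
  openAt k u (app t s) = app (openAt k u t) (openAt k u s)
  openAt k u (dm n ρ) = dm n ρ
  openAt k u (U m V t) = U m V (openAt k u t)
  openAt k u (meas m t) = meas m (openAt k u t)
  openAt k u (t ⊗ s) = openAt k u t ⊗ openAt k u s
  openAt k u (letcase° m r ts) = letcase° m (openAt k u r) (λ i → openAt (suc k) u (ts i))
  openAt k u (psum j p ts) = psum j p (λ i → openAt k u (ts i))

  _^^_ : Term → Name → Term
  t ^^ x = openAt 0 (fvar x) t

  _[_/_] : Term → Term → Name → Term
  bvar i [ r / x ] = bvar i
  fvar y [ r / x ] with y ≟ x
  ... | yes _ = r
  ... | no _  = fvar y
  lam t [ r / x ] = lam (t [ r / x ])
  app t s [ r / x ] = app (t [ r / x ]) (s [ r / x ])
  dm n ρ [ r / x ] = dm n ρ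
  U m V t [ r / x ] = U m V (t [ r / x ])
  meas m t [ r / x ] = meas m (t [ r / x ])
  (t ⊗ s) [ r / x ] = (t [ r / x ]) ⊗ (s [ r / x ])
  letcase° m s ts [ r / x ] = letcase° m (s [ r / x ]) (λ i → ts i [ r / x ])
  psum j p ts [ r / x ] = psum j p (λ i → ts i [ r / x ])

  infix 4 _⊩_∶_

  data _⊩_∶_ : Ctx → Term → Ty → Set where
    ax   : ∀ {Θ x A} → Ok Θ → (x , A) ∈ Θ → Θ ⊩ fvar x ∶ A
    ⊸i   : ∀ {Γ t A B} (L : List Name) →
           (∀ x → x ∉ L → ((x , A) ∷ Γ) ⊩ t ^^ x ∶ B) →
           Γ ⊩ lam t ∶ A ⊸ B
    ⊸e   : ∀ {Θ Γ Δ t r A B} → Θ ≅ Γ ,, Δ →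
           Γ ⊩ t ∶ A ⊸ B → Δ ⊩ r ∶ A → Θ ⊩ app t r ∶ B
    ax-ρ : ∀ {Γ n ρ} → Ok Γ → Γ ⊩ dm n ρ ∶ qb n
    u    : ∀ {Γ t n m V} → Γ ⊩ t ∶ qb n → Γ ⊩ U m V t ∶ qb n
    π    : ∀ {Γ t n m} (p : m ≤ n) → Γ ⊩ t ∶ qb n → Γ ⊩ meas m t ∶ cqb m n p
    ⊗    : ∀ {Θ Γ Δ t r n m} → Θ ≅ Γ ,, Δ →
           Γ ⊩ t ∶ qb n → Δ ⊩ r ∶ qb m → Θ ⊩ t ⊗ r ∶ qb (n + m)
    lc   : ∀ {Γ m n p r A} {ts : Fin (2 ^ m) → Term} (L : List Name) →
           (∀ i x → x ∉ L → ((x , qb n) ∷ []) ⊩ ts i ^^ x ∶ A) →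
           Γ ⊩ r ∶ cqb m n p → Γ ⊩ letcase° m r ts ∶ A
    +    : ∀ {Γ k A} {p : Fin (suc k) → Prob} {ts : Fin (suc k) → Term} →
           IsDist k p → (∀ i → Γ ⊩ ts i ∶ A) → Γ ⊩ psum k p ts ∶ A

-- The
-- substitution lemma follows by induction on the typing derivation of t, with
-- its context presented as  x:A , Γ  up to reordering: in the binary rules
-- (application, tensor) the substitution enters the premise declaring x and
-- leaves the other one untouched, and the branches of letcase, typed in a
-- singleton context, are untouched as well.  lemma8 takes the trivial reordering.

module Submission where

open import Defs
open import Function using (_∘_)
open import Data.List using (List; []; _∷_; _++_; map)
open import Data.List.Properties using (map-++)
open import Data.List.Extrema.Nat using (max; xs≤max)
open import Data.Product using (Σ; _×_; _,_; proj₁; proj₂)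
open import Data.Sum using (_⊎_; inj₁; inj₂)
open import Data.Nat using (ℕ; suc; _≤_; _<_; _^_; z≤n; s≤s; _≟_)
open import Data.Nat.Properties using (≤-trans; 1+n≰n; m<n⇒m<1+n; n<1+n)
open import Data.Fin using (Fin)
open import Data.Unit using (⊤; tt)
open import Data.Empty using (⊥-elim)
open import Relation.Nullary using (yes; no)
open import Relation.Binary.PropositionalEquality using (setoid; _≡_; _≢_; refl; sym; subst)
open import Data.List.Relation.Unary.All using (lookup)
open import Data.List.Relation.Unary.All.Properties using (¬Any⇒All¬; All¬⇒¬Any; ++⁻ˡ)
open import Data.List.Relation.Unary.AllPairs using ([]; _∷_)
open import Data.List.Relation.Unary.Any using (here; there)
open import Data.List.Relation.Unary.Unique.Propositional using (Unique)
open import Data.List.Membership.Propositional using (_∈_; _∉_)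
open import Data.List.Membership.Propositional.Properties using (∈-++⁺ˡ; ∈-++⁺ʳ; ∈-++⁻; ∈-∃++; ∈-map⁺)
open import Data.List.Relation.Binary.Subset.Propositional using (_⊆_)
open import Data.List.Relation.Binary.Subset.Propositional.Properties using (xs⊆xs++ys; ⊆-reflexive-↭)
import Data.List.Relation.Binary.Subset.Propositional.Properties as ⊆
open import Data.List.Relation.Binary.Permutation.Propositional
  using (_↭_; ↭-refl; ↭-sym; ↭-trans; ↭-prep; ↭-swap; ↭⇒↭ₛ; module PermutationReasoning)
open import Data.List.Relation.Binary.Permutation.Propositional.Properties
  using (∈-resp-↭; ++⁺ˡ; ++⁺ʳ; ++-comm; shift; drop-∷)
import Data.List.Relation.Binary.Permutation.Propositional.Properties as ↭
open import Data.List.Relation.Binary.Permutation.Setoid.Properties (setoid Name)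
  using (Unique-resp-↭)

fresh : (L : List Name) → Σ Name (λ y → y ∉ L)
fresh L = suc (max 0 L) , λ y∈L → 1+n≰n (lookup (xs≤max 0 L) y∈L)

∉-∷ : ∀ {x y : Name} {xs} → y ≢ x → x ∉ xs → x ∉ y ∷ xs
∉-∷ y≢x x∉ (here x≡y) = y≢x (sym x≡y)
∉-∷ y≢x x∉ (there x∈) = x∉ x∈

dom : Ctx → List Name
dom = map proj₁

declared : ∀ {x A} {Θ : Ctx} → (x , A) ∈ Θ → x ∈ dom Θ
declared = ∈-map⁺ proj₁

∉-⊆ : ∀ {x} {Γ Θ : Ctx} → Γ ⊆ Θ → x ∉ dom Θ → x ∉ dom Γ
∉-⊆ Γ⊆Θ x∉ = x∉ ∘ ⊆.map⁺ proj₁ Γ⊆Θ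

Ok-∷ : ∀ {x A} {Θ : Ctx} → x ∉ dom Θ → Ok Θ → Ok ((x , A) ∷ Θ)
Ok-∷ x∉ ok = ¬Any⇒All¬ _ x∉ ∷ ok

Ok-resp-↭ : ∀ {Θ Θ' : Ctx} → Θ ↭ Θ' → Ok Θ → Ok Θ'
Ok-resp-↭ Θ↭Θ' = Unique-resp-↭ (↭⇒↭ₛ (↭.map⁺ proj₁ Θ↭Θ'))

Ok-unique : ∀ {x A B} {Θ : Ctx} → Ok Θ → (x , A) ∈ Θ → (x , B) ∈ Θ → A ≡ B
Ok-unique (_  ∷ _)  (here refl) (here refl) = refl
Ok-unique (x∉ ∷ _)  (here refl) (there m)   = ⊥-elim (All¬⇒¬Any x∉ (declared m))
Ok-unique (x∉ ∷ _)  (there m)   (here refl) = ⊥-elim (All¬⇒¬Any x∉ (declared m))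
Ok-unique (_  ∷ ok) (there m)   (there m')  = Ok-unique ok m m'

unique-++ˡ : ∀ (xs : List Name) {ys} → Unique (xs ++ ys) → Unique xs
unique-++ˡ []       _        = []
unique-++ˡ (_ ∷ xs) (x∉ ∷ u) = ++⁻ˡ xs x∉ ∷ unique-++ˡ xs u

unique-disjoint : ∀ (xs : List Name) {ys x} → Unique (xs ++ ys) → x ∈ xs → x ∉ ys
unique-disjoint (_ ∷ xs) (x∉ ∷ _) (here refl) x∈ys = All¬⇒¬Any x∉ (∈-++⁺ʳ xs x∈ys)
unique-disjoint (_ ∷ xs) (_ ∷ u)  (there x∈)  = unique-disjoint xs u x∈

Ok-++ˡ : ∀ (Γ : Ctx) {Δ} → Ok (Γ ++ Δ) → Ok Γ
Ok-++ˡ Γ {Δ} ok = unique-++ˡ (dom Γ) (subst Unique (map-++ proj₁ Γ Δ) ok)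

Ok-disjoint : ∀ (Γ : Ctx) {Δ x} → Ok (Γ ++ Δ) → x ∈ dom Γ → x ∉ dom Δ
Ok-disjoint Γ {Δ} ok = unique-disjoint (dom Γ) (subst Unique (map-++ proj₁ Γ Δ) ok)

≅-okˡ : ∀ {Θ Γ Δ} → Θ ≅ Γ ,, Δ → Ok Γ
≅-okˡ {Γ = Γ} (ok , Θ↭) = Ok-++ˡ Γ (Ok-resp-↭ Θ↭ ok)

≅-comm : ∀ {Θ Γ Δ} → Θ ≅ Γ ,, Δ → Θ ≅ Δ ,, Γ
≅-comm {Γ = Γ} {Δ} (ok , Θ↭) = ok , ↭-trans Θ↭ (++-comm Γ Δ)

≅-⊆ˡ : ∀ {Θ Γ Δ} → Θ ≅ Γ ,, Δ → Γ ⊆ Θ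
≅-⊆ˡ {Γ = Γ} {Δ} (_ , Θ↭) = ⊆-reflexive-↭ (↭-sym Θ↭) ∘ xs⊆xs++ys Γ Δ

≅-⊆ʳ : ∀ {Θ Γ Δ} → Θ ≅ Γ ,, Δ → Δ ⊆ Θ
≅-⊆ʳ {Γ = Γ} {Δ} s = ≅-⊆ˡ {Γ = Δ} {Γ} (≅-comm {Γ = Γ} {Δ} s)

≅-assoc : ∀ {Θ' E Θ Γ Δ} → Θ' ≅ E ,, Θ → Θ ≅ Γ ,, Δ → Θ' ≅ (E ++ Γ) ,, Δ
≅-assoc {E = E} {Γ = Γ} {Δ} (ok , Θ'↭) (_ , Θ↭) =
  ok , ↭-trans Θ'↭ (↭-trans (++⁺ˡ E Θ↭) (↭-sym (↭.++-assoc E Γ Δ)))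

≅-∷ʳ : ∀ {Θ Γ Δ y A} → y ∉ dom Θ → Θ ≅ Γ ,, Δ → ((y , A) ∷ Θ) ≅ Γ ,, ((y , A) ∷ Δ)
≅-∷ʳ {Γ = Γ} {Δ} {y} {A} y∉ (ok , Θ↭) =
  Ok-∷ {A = A} y∉ ok , ↭-trans (↭-prep (y , A) Θ↭) (↭-sym (shift (y , A) Γ Δ))

++-exchange : ∀ (as bs cs : Ctx) → (as ++ bs) ++ cs ↭ (as ++ cs) ++ bs
++-exchange as bs cs = begin
  (as ++ bs) ++ cs  ↭⟨ ↭.++-assoc as bs cs ⟩
  as ++ (bs ++ cs)  ↭⟨ ++⁺ˡ as (++-comm bs cs) ⟩
  as ++ (cs ++ bs)  ↭⟨ ↭.++-assoc as cs bs ⟨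
  (as ++ cs) ++ bs  ∎
  where open PermutationReasoning

∈-others : ∀ {Θ Γ : Ctx} {x A z B} → Θ ↭ (x , A) ∷ Γ → (z , B) ∈ Θ → z ≢ x → (z , B) ∈ Γ
∈-others Θ↭ z∈ z≢x with ∈-resp-↭ Θ↭ z∈
... | here refl = ⊥-elim (z≢x refl)
... | there z∈Γ = z∈Γ

record Focus (x : Name) (A : Ty) (Γ Δ Θ₁ Θ₂ : Ctx) : Set where
  field
    rest   : Ctx
    dropx  : Θ₁ ↭ (x , A) ∷ rest
    joined : (Γ ++ Δ) ≅ (rest ++ Δ) ,, Θ₂
    absent : x ∉ dom Θ₂

focus : ∀ {Θ Γ Δ Θ₁ Θ₂ x A} → Θ ≅ Θ₁ ,, Θ₂ → Θ ↭ (x , A) ∷ Γ → Ok (Γ ++ Δ) →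
        (x , A) ∈ Θ₁ → Focus x A Γ Δ Θ₁ Θ₂
focus {Γ = Γ} {Δ} {Θ₂ = Θ₂} {x} {A} (okΘ , Θ↭) Θ↭x ok x∈ with as , bs , refl ← ∈-∃++ x∈ =
  record { rest   = as ++ bs
         ; dropx  = shift (x , A) as bs
         ; joined = ok , ↭-trans (++⁺ʳ Δ Γ↭) (++-exchange (as ++ bs) Θ₂ Δ)
         ; absent = Ok-disjoint (as ++ (x , A) ∷ bs) (Ok-resp-↭ Θ↭ okΘ) (declared x∈)
         }
  where
    Γ↭ : Γ ↭ (as ++ bs) ++ Θ₂
    Γ↭ = drop-∷ (↭-trans (↭-sym Θ↭x) (↭-trans Θ↭ (++⁺ʳ Θ₂ (shift (x , A) as bs))))

locate : ∀ {Θ Γ Δ Θ₁ Θ₂ x A} → Θ ≅ Θ₁ ,, Θ₂ → Θ ↭ (x , A) ∷ Γ → Ok (Γ ++ Δ) →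
         Focus x A Γ Δ Θ₁ Θ₂ ⊎ Focus x A Γ Δ Θ₂ Θ₁
locate {Θ₁ = Θ₁} {Θ₂} s Θ↭x ok with ∈-++⁻ Θ₁ (∈-resp-↭ (proj₂ s) (∈-resp-↭ (↭-sym Θ↭x) (here refl)))
... | inj₁ x∈Θ₁ = inj₁ (focus s Θ↭x ok x∈Θ₁)
... | inj₂ x∈Θ₂ = inj₂ (focus (≅-comm {Γ = Θ₁} {Θ₂} s) Θ↭x ok x∈Θ₂)

module TypingLρ (𝔸 : Annot) where
  open Lρ 𝔸

  -- Structural equality of terms: equality up to pointwise equality of the
  -- branch families of letcase (≡ would need function extensionality there).
  infix 4 _≈_
  data _≈_ : Term → Term → Set where
    bvar≈ : ∀ i → bvar i ≈ bvar i
    fvar≈ : ∀ y → fvar y ≈ fvar y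
    lam≈  : ∀ {t t'} → t ≈ t' → lam t ≈ lam t'
    app≈  : ∀ {t t' s s'} → t ≈ t' → s ≈ s' → app t s ≈ app t' s'
    dm≈   : ∀ n ρ → dm n ρ ≈ dm n ρ
    U≈    : ∀ {t t'} m V → t ≈ t' → U m V t ≈ U m V t'
    meas≈ : ∀ {t t'} m → t ≈ t' → meas m t ≈ meas m t'
    ⊗≈    : ∀ {t t' s s'} → t ≈ t' → s ≈ s' → (_⊗_ t s) ≈ (_⊗_ t' s')
    cval≈ : ∀ m n p b ρ → cval m n p b ρ ≈ cval m n p b ρ
    lc≈   : ∀ m {r r'} {ts ts' : Fin (2 ^ m) → Term} →
            r ≈ r' → (∀ i → ts i ≈ ts' i) → letcase m r ts ≈ letcase m r' ts'

  ≈-refl : ∀ t → t ≈ t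
  ≈-refl (bvar i)         = bvar≈ i
  ≈-refl (fvar y)         = fvar≈ y
  ≈-refl (lam t)          = lam≈ (≈-refl t)
  ≈-refl (app t s)        = app≈ (≈-refl t) (≈-refl s)
  ≈-refl (dm n ρ)         = dm≈ n ρ
  ≈-refl (U m V t)        = U≈ m V (≈-refl t)
  ≈-refl (meas m t)       = meas≈ m (≈-refl t)
  ≈-refl (_⊗_ t s)        = ⊗≈ (≈-refl t) (≈-refl s)
  ≈-refl (cval m n p b ρ) = cval≈ m n p b ρ
  ≈-refl (letcase m r ts) = lc≈ m (≈-refl r) (≈-refl ∘ ts)

  open-resp : ∀ k w {t t'} → t ≈ t' → openAt k w t ≈ openAt k w t'
  open-resp k w (bvar≈ i)         = ≈-refl _
  open-resp k w (fvar≈ y)         = fvar≈ y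
  open-resp k w (lam≈ e)          = lam≈ (open-resp (suc k) w e)
  open-resp k w (app≈ e f)        = app≈ (open-resp k w e) (open-resp k w f)
  open-resp k w (dm≈ n ρ)         = dm≈ n ρ
  open-resp k w (U≈ m V e)        = U≈ m V (open-resp k w e)
  open-resp k w (meas≈ m e)       = meas≈ m (open-resp k w e)
  open-resp k w (⊗≈ e f)          = ⊗≈ (open-resp k w e) (open-resp k w f)
  open-resp k w (cval≈ m n p b ρ) = cval≈ m n p b ρ
  open-resp k w (lc≈ m e es)      = lc≈ m (open-resp k w e) (open-resp (suc k) w ∘ es)

  ⊢-resp : ∀ {Γ t t' B} → Γ ⊢ t ∶ B → t ≈ t' → Γ ⊢ t' ∶ B
  ⊢-resp (ax ok x∈)   (fvar≈ _)     = ax ok x∈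
  ⊢-resp (⊸i L f)     (lam≈ e)      = ⊸i L (λ y y∉ → ⊢-resp (f y y∉) (open-resp 0 (fvar y) e))
  ⊢-resp (⊸e s d₁ d₂) (app≈ e₁ e₂)  = ⊸e s (⊢-resp d₁ e₁) (⊢-resp d₂ e₂)
  ⊢-resp (ax-ρ ok)    (dm≈ _ _)     = ax-ρ ok
  ⊢-resp (u d)        (U≈ _ _ e)    = u (⊢-resp d e)
  ⊢-resp (π p d)      (meas≈ _ e)   = π p (⊢-resp d e)
  ⊢-resp (⊗ s d₁ d₂)  (⊗≈ e₁ e₂)    = ⊗ s (⊢-resp d₁ e₁) (⊢-resp d₂ e₂)
  ⊢-resp (ax-b ok)    (cval≈ _ _ _ _ _) = ax-b ok
  ⊢-resp (lc L f d)   (lc≈ _ e es)  =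
    lc L (λ i y y∉ → ⊢-resp (f i y y∉) (open-resp 0 (fvar y) (es i))) (⊢-resp d e)

  Fresh : Name → Term → Set
  Fresh x (bvar i)         = ⊤
  Fresh x (fvar y)         = y ≢ x
  Fresh x (lam t)          = Fresh x t
  Fresh x (app t s)        = Fresh x t × Fresh x s
  Fresh x (dm n ρ)         = ⊤
  Fresh x (U m V t)        = Fresh x t
  Fresh x (meas m t)       = Fresh x t
  Fresh x (_⊗_ t s)        = Fresh x t × Fresh x s
  Fresh x (cval m n p b ρ) = ⊤
  Fresh x (letcase m r ts) = Fresh x r × (∀ i → Fresh x (ts i))

  fresh-open : ∀ {x} k w t → Fresh x (openAt k w t) → Fresh x t
  fresh-open k w (bvar i)         _         = tt
  fresh-open k w (fvar y)         y≢x       = y≢x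
  fresh-open k w (lam t)          h         = fresh-open (suc k) w t h
  fresh-open k w (app t s)        (h₁ , h₂) = fresh-open k w t h₁ , fresh-open k w s h₂
  fresh-open k w (dm n ρ)         _         = tt
  fresh-open k w (U m V t)        h         = fresh-open k w t h
  fresh-open k w (meas m t)       h         = fresh-open k w t h
  fresh-open k w (_⊗_ t s)        (h₁ , h₂) = fresh-open k w t h₁ , fresh-open k w s h₂
  fresh-open k w (cval m n p b ρ) _         = tt
  fresh-open k w (letcase m r ts) (h₁ , h₂) =
    fresh-open k w r h₁ , λ i → fresh-open (suc k) w (ts i) (h₂ i)

  fresh-subst : ∀ {x r} t → Fresh x t → t ≈ t [ r / x ]
  fresh-subst (bvar i)         _         = bvar≈ i
  fresh-subst {x} (fvar y)     y≢x with y ≟ x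
  ... | yes y≡x = ⊥-elim (y≢x y≡x)
  ... | no _    = fvar≈ y
  fresh-subst (lam t)          h         = lam≈ (fresh-subst t h)
  fresh-subst (app t s)        (h₁ , h₂) = app≈ (fresh-subst t h₁) (fresh-subst s h₂)
  fresh-subst (dm n ρ)         _         = dm≈ n ρ
  fresh-subst (U m V t)        h         = U≈ m V (fresh-subst t h)
  fresh-subst (meas m t)       h         = meas≈ m (fresh-subst t h)
  fresh-subst (_⊗_ t s)        (h₁ , h₂) = ⊗≈ (fresh-subst t h₁) (fresh-subst s h₂)
  fresh-subst (cval m n p b ρ) _         = cval≈ m n p b ρ
  fresh-subst (letcase m r ts) (h₁ , h₂) = lc≈ m (fresh-subst r h₁) (λ i → fresh-subst (ts i) (h₂ i))

  typed-fresh : ∀ {Θ t B x} → Θ ⊢ t ∶ B → x ∉ dom Θ → Fresh x t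
  typed-fresh (ax _ z∈) x∉ refl = x∉ (declared z∈)
  typed-fresh {x = x} (⊸i {t = t} L f) x∉ =
    let (y , y∉) = fresh (x ∷ L)
    in fresh-open 0 (fvar y) t (typed-fresh (f y (y∉ ∘ there)) (∉-∷ (y∉ ∘ here) x∉))
  typed-fresh (⊸e s d₁ d₂) x∉ = typed-fresh d₁ (∉-⊆ (≅-⊆ˡ s) x∉) , typed-fresh d₂ (∉-⊆ (≅-⊆ʳ s) x∉)
  typed-fresh (ax-ρ _)     _  = tt
  typed-fresh (u d)        x∉ = typed-fresh d x∉
  typed-fresh (π _ d)      x∉ = typed-fresh d x∉
  typed-fresh (⊗ s d₁ d₂)  x∉ = typed-fresh d₁ (∉-⊆ (≅-⊆ˡ s) x∉) , typed-fresh d₂ (∉-⊆ (≅-⊆ʳ s) x∉)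
  typed-fresh (ax-b _)     _  = tt
  typed-fresh {x = x} (lc {ts = ts} L f d) x∉ =
    typed-fresh d x∉ , λ i →
      let (y , y∉) = fresh (x ∷ L)
      in fresh-open 0 (fvar y) (ts i) (typed-fresh (f i y (y∉ ∘ there)) (∉-∷ (y∉ ∘ here) λ ()))

  Closed : ℕ → Term → Set
  Closed k (bvar i)         = i < k
  Closed k (fvar y)         = ⊤
  Closed k (lam t)          = Closed (suc k) t
  Closed k (app t s)        = Closed k t × Closed k s
  Closed k (dm n ρ)         = ⊤
  Closed k (U m V t)        = Closed k t
  Closed k (meas m t)       = Closed k t
  Closed k (_⊗_ t s)        = Closed k t × Closed k s
  Closed k (cval m n p b ρ) = ⊤
  Closed k (letcase m r ts) = Closed k r × (∀ i → Closed (suc k) (ts i))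

  closed-open : ∀ k w t → Closed k (openAt k w t) → Closed (suc k) t
  closed-open k w (bvar i) h with i ≟ k
  ... | yes refl = n<1+n i
  ... | no _     = m<n⇒m<1+n h
  closed-open k w (fvar y)         _         = tt
  closed-open k w (lam t)          h         = closed-open (suc k) w t h
  closed-open k w (app t s)        (h₁ , h₂) = closed-open k w t h₁ , closed-open k w s h₂
  closed-open k w (dm n ρ)         _         = tt
  closed-open k w (U m V t)        h         = closed-open k w t h
  closed-open k w (meas m t)       h         = closed-open k w t h
  closed-open k w (_⊗_ t s)        (h₁ , h₂) = closed-open k w t h₁ , closed-open k w s h₂
  closed-open k w (cval m n p b ρ) _         = tt
  closed-open k w (letcase m r ts) (h₁ , h₂) =
    closed-open k w r h₁ , λ i → closed-open (suc k) w (ts i) (h₂ i)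

  closed-open-id : ∀ {k j} w t → k ≤ j → Closed k t → t ≈ openAt j w t
  closed-open-id {j = j} w (bvar i) k≤j i<k with i ≟ j
  ... | yes refl = ⊥-elim (1+n≰n (≤-trans i<k k≤j))
  ... | no _     = bvar≈ i
  closed-open-id w (fvar y)         _   _         = fvar≈ y
  closed-open-id w (lam t)          k≤j h         = lam≈ (closed-open-id w t (s≤s k≤j) h)
  closed-open-id w (app t s)        k≤j (h₁ , h₂) =
    app≈ (closed-open-id w t k≤j h₁) (closed-open-id w s k≤j h₂)
  closed-open-id w (dm n ρ)         _   _         = dm≈ n ρ
  closed-open-id w (U m V t)        k≤j h         = U≈ m V (closed-open-id w t k≤j h)
  closed-open-id w (meas m t)       k≤j h         = meas≈ m (closed-open-id w t k≤j h)
  closed-open-id w (_⊗_ t s)        k≤j (h₁ , h₂) =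
    ⊗≈ (closed-open-id w t k≤j h₁) (closed-open-id w s k≤j h₂)
  closed-open-id w (cval m n p b ρ) _   _         = cval≈ m n p b ρ
  closed-open-id w (letcase m r ts) k≤j (h₁ , h₂) =
    lc≈ m (closed-open-id w r k≤j h₁) (λ i → closed-open-id w (ts i) (s≤s k≤j) (h₂ i))

  typed-closed : ∀ {Γ t B} → Γ ⊢ t ∶ B → Closed 0 t
  typed-closed (ax _ _) = tt
  typed-closed (⊸i {t = t} L f) =
    let (y , y∉) = fresh L in closed-open 0 (fvar y) t (typed-closed (f y y∉))
  typed-closed (⊸e _ d₁ d₂) = typed-closed d₁ , typed-closed d₂
  typed-closed (ax-ρ _)     = tt
  typed-closed (u d)        = typed-closed d
  typed-closed (π _ d)      = typed-closed d
  typed-closed (⊗ _ d₁ d₂)  = typed-closed d₁ , typed-closed d₂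
  typed-closed (ax-b _)     = tt
  typed-closed (lc {ts = ts} L f d) =
    typed-closed d , λ i →
      let (y , y∉) = fresh L in closed-open 0 (fvar y) (ts i) (typed-closed (f i y y∉))

  open-subst : ∀ {x y r} → Closed 0 r → y ≢ x → ∀ k t →
               openAt k (fvar y) t [ r / x ] ≈ openAt k (fvar y) (t [ r / x ])
  open-subst {x} {y} _ y≢x k (bvar i) with i ≟ k
  ... | no _  = bvar≈ i
  ... | yes _ with y ≟ x
  ...   | yes y≡x = ⊥-elim (y≢x y≡x)
  ...   | no _    = fvar≈ y
  open-subst {x} {r = r} cl _ k (fvar z) with z ≟ x
  ... | yes _ = closed-open-id _ r z≤n cl
  ... | no _  = fvar≈ z
  open-subst cl y≢x k (lam t)          = lam≈ (open-subst cl y≢x (suc k) t)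
  open-subst cl y≢x k (app t s)        = app≈ (open-subst cl y≢x k t) (open-subst cl y≢x k s)
  open-subst cl y≢x k (dm n ρ)         = dm≈ n ρ
  open-subst cl y≢x k (U m V t)        = U≈ m V (open-subst cl y≢x k t)
  open-subst cl y≢x k (meas m t)       = meas≈ m (open-subst cl y≢x k t)
  open-subst cl y≢x k (_⊗_ t s)        = ⊗≈ (open-subst cl y≢x k t) (open-subst cl y≢x k s)
  open-subst cl y≢x k (cval m n p b ρ) = cval≈ m n p b ρ
  open-subst cl y≢x k (letcase m r ts) =
    lc≈ m (open-subst cl y≢x k r) (λ i → open-subst cl y≢x (suc k) (ts i))

  weaken : ∀ {Θ E Γ t B} → Γ ⊢ t ∶ B → Θ ≅ E ,, Γ → Θ ⊢ t ∶ B
  weaken (ax _ x∈) w = ax (proj₁ w) (≅-⊆ʳ w x∈)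
  weaken {Θ} {E} {Γ} (⊸i L f) w =
    ⊸i (L ++ dom Θ) λ y y∉ → weaken (f y (y∉ ∘ ∈-++⁺ˡ)) (≅-∷ʳ {Γ = E} {Γ} (y∉ ∘ ∈-++⁺ʳ L) w)
  weaken {E = E} (⊸e {Γ = Γ₁} s d₁ d₂) w =
    ⊸e (≅-assoc w s) (weaken d₁ (≅-okˡ {Γ = E ++ Γ₁} (≅-assoc w s) , ↭-refl)) d₂
  weaken (ax-ρ _) w = ax-ρ (proj₁ w)
  weaken (u d)    w = u (weaken d w)
  weaken (π p d)  w = π p (weaken d w)
  weaken {E = E} (⊗ {Γ = Γ₁} s d₁ d₂) w =
    ⊗ (≅-assoc w s) (weaken d₁ (≅-okˡ {Γ = E ++ Γ₁} (≅-assoc w s) , ↭-refl)) d₂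
  weaken (ax-b _)   w = ax-b (proj₁ w)
  weaken (lc L f d) w = lc L f (weaken d w)

  subst-absent : ∀ {Γ t B x r} → Γ ⊢ t ∶ B → x ∉ dom Γ → Γ ⊢ t [ r / x ] ∶ B
  subst-absent {t = t} d x∉ = ⊢-resp d (fresh-subst t (typed-fresh d x∉))

  data Premises (Ξ : Ctx) (t₁ t₂ : Term) (B₁ B₂ : Ty) : Set where
    premises : ∀ {Ξ₁ Ξ₂} → Ξ ≅ Ξ₁ ,, Ξ₂ → Ξ₁ ⊢ t₁ ∶ B₁ → Ξ₂ ⊢ t₂ ∶ B₂ → Premises Ξ t₁ t₂ B₁ B₂

  -- The variable x becomes r weakened from Δ to  Γ , Δ  (x has type A because Θ
  -- is well formed); binders are opened with a name fresh for everything, which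
  -- commutes with the substitution; in a binary rule x is declared in exactly
  -- one premise and the other is unaffected (subst-premises).
  substitution : ∀ {Θ Γ Δ x A B t r} → Θ ⊢ t ∶ B → Θ ↭ (x , A) ∷ Γ → Δ ⊢ r ∶ A →
                 Ok (Γ ++ Δ) → (Γ ++ Δ) ⊢ t [ r / x ] ∶ B
  subst-premises : ∀ {Θ Θ₁ Θ₂ Γ Δ x A B₁ B₂ t₁ t₂ r} → Θ ≅ Θ₁ ,, Θ₂ →
                   Θ₁ ⊢ t₁ ∶ B₁ → Θ₂ ⊢ t₂ ∶ B₂ → Θ ↭ (x , A) ∷ Γ → Δ ⊢ r ∶ A →
                   Ok (Γ ++ Δ) → Premises (Γ ++ Δ) (t₁ [ r / x ]) (t₂ [ r / x ]) B₁ B₂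

  substitution {Γ = Γ} {Δ} {x} (ax {x = z} okΘ z∈) Θ↭ dr ok with z ≟ x
  ... | yes refl = subst (λ C → (Γ ++ Δ) ⊢ _ ∶ C)
                         (Ok-unique okΘ (∈-resp-↭ (↭-sym Θ↭) (here refl)) z∈)
                         (weaken dr (ok , ↭-refl))
  ... | no z≢x   = ax ok (∈-++⁺ˡ (∈-others Θ↭ z∈ z≢x))
  substitution {Γ = Γ} {Δ} {x} (⊸i {t = t} {A = A'} L f) Θ↭ dr ok =
    ⊸i (x ∷ L ++ dom (Γ ++ Δ)) λ y y∉ →
      ⊢-resp (substitution (f y (y∉ ∘ there ∘ ∈-++⁺ˡ))
                           (↭-trans (↭-prep _ Θ↭) (↭-swap _ _ ↭-refl)) dr
                           (Ok-∷ {A = A'} (y∉ ∘ there ∘ ∈-++⁺ʳ L) ok))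
             (open-subst (typed-closed dr) (y∉ ∘ here) 0 t)
  substitution (⊸e s d₁ d₂) Θ↭ dr ok with subst-premises s d₁ d₂ Θ↭ dr ok
  ... | premises s' d₁' d₂' = ⊸e s' d₁' d₂'
  substitution (ax-ρ _) _  _  ok = ax-ρ ok
  substitution (u d)    Θ↭ dr ok = u (substitution d Θ↭ dr ok)
  substitution (π p d)  Θ↭ dr ok = π p (substitution d Θ↭ dr ok)
  substitution (⊗ s d₁ d₂) Θ↭ dr ok with subst-premises s d₁ d₂ Θ↭ dr ok
  ... | premises s' d₁' d₂' = ⊗ s' d₁' d₂'
  substitution (ax-b _) _  _  ok = ax-b ok
  substitution {x = x} (lc {ts = ts} L f d) Θ↭ dr ok =
    lc (x ∷ L) (λ i y y∉ → ⊢-resp (subst-absent (f i y (y∉ ∘ there)) (∉-∷ (y∉ ∘ here) λ ()))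
                                  (open-subst (typed-closed dr) (y∉ ∘ here) 0 (ts i)))
       (substitution d Θ↭ dr ok)

  subst-premises s d₁ d₂ Θ↭ dr ok with locate s Θ↭ ok
  ... | inj₁ F = let open Focus F in
    premises joined
             (substitution d₁ dropx dr (≅-okˡ {Γ = rest ++ _} joined))
             (subst-absent d₂ absent)
  ... | inj₂ F = let open Focus F in
    premises (≅-comm {Γ = rest ++ _} joined)
             (subst-absent d₁ absent)
             (substitution d₂ dropx dr (≅-okˡ {Γ = rest ++ _} joined))

-- The same development for λρ°, where classical values give way to
-- probabilistic sums, whose rule types every summand in the whole context.
module TypingLρ° (𝔸 : Annot) where
  open Lρ° 𝔸

  -- Structural equality of terms: equality up to pointwise equality of the
  -- families of letcase° branches and of summands (≡ would need function
  -- extensionality there).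
  infix 4 _≈_
  data _≈_ : Term → Term → Set where
    bvar≈ : ∀ i → bvar i ≈ bvar i
    fvar≈ : ∀ y → fvar y ≈ fvar y
    lam≈  : ∀ {t t'} → t ≈ t' → lam t ≈ lam t'
    app≈  : ∀ {t t' s s'} → t ≈ t' → s ≈ s' → app t s ≈ app t' s'
    dm≈   : ∀ n ρ → dm n ρ ≈ dm n ρ
    U≈    : ∀ {t t'} m V → t ≈ t' → U m V t ≈ U m V t'
    meas≈ : ∀ {t t'} m → t ≈ t' → meas m t ≈ meas m t'
    ⊗≈    : ∀ {t t' s s'} → t ≈ t' → s ≈ s' → (_⊗_ t s) ≈ (_⊗_ t' s')
    psum≈ : ∀ k p {ts ts' : Fin (suc k) → Term} → (∀ i → ts i ≈ ts' i) → psum k p ts ≈ psum k p ts'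
    lc≈   : ∀ m {r r'} {ts ts' : Fin (2 ^ m) → Term} →
            r ≈ r' → (∀ i → ts i ≈ ts' i) → letcase° m r ts ≈ letcase° m r' ts'

  ≈-refl : ∀ t → t ≈ t
  ≈-refl (bvar i)          = bvar≈ i
  ≈-refl (fvar y)          = fvar≈ y
  ≈-refl (lam t)           = lam≈ (≈-refl t)
  ≈-refl (app t s)         = app≈ (≈-refl t) (≈-refl s)
  ≈-refl (dm n ρ)          = dm≈ n ρ
  ≈-refl (U m V t)         = U≈ m V (≈-refl t)
  ≈-refl (meas m t)        = meas≈ m (≈-refl t)
  ≈-refl (_⊗_ t s)         = ⊗≈ (≈-refl t) (≈-refl s)
  ≈-refl (psum k p ts)     = psum≈ k p (≈-refl ∘ ts)
  ≈-refl (letcase° m r ts) = lc≈ m (≈-refl r) (≈-refl ∘ ts)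

  open-resp : ∀ k w {t t'} → t ≈ t' → openAt k w t ≈ openAt k w t'
  open-resp k w (bvar≈ i)         = ≈-refl _
  open-resp k w (fvar≈ y)         = fvar≈ y
  open-resp k w (lam≈ e)          = lam≈ (open-resp (suc k) w e)
  open-resp k w (app≈ e f)        = app≈ (open-resp k w e) (open-resp k w f)
  open-resp k w (dm≈ n ρ)         = dm≈ n ρ
  open-resp k w (U≈ m V e)        = U≈ m V (open-resp k w e)
  open-resp k w (meas≈ m e)       = meas≈ m (open-resp k w e)
  open-resp k w (⊗≈ e f)          = ⊗≈ (open-resp k w e) (open-resp k w f)
  open-resp k w (psum≈ j p es)    = psum≈ j p (open-resp k w ∘ es)
  open-resp k w (lc≈ m e es)      = lc≈ m (open-resp k w e) (open-resp (suc k) w ∘ es)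

  ⊩-resp : ∀ {Γ t t' B} → Γ ⊩ t ∶ B → t ≈ t' → Γ ⊩ t' ∶ B
  ⊩-resp (ax ok x∈)   (fvar≈ _)     = ax ok x∈
  ⊩-resp (⊸i L f)     (lam≈ e)      = ⊸i L (λ y y∉ → ⊩-resp (f y y∉) (open-resp 0 (fvar y) e))
  ⊩-resp (⊸e s d₁ d₂) (app≈ e₁ e₂)  = ⊸e s (⊩-resp d₁ e₁) (⊩-resp d₂ e₂)
  ⊩-resp (ax-ρ ok)    (dm≈ _ _)     = ax-ρ ok
  ⊩-resp (u d)        (U≈ _ _ e)    = u (⊩-resp d e)
  ⊩-resp (π p d)      (meas≈ _ e)   = π p (⊩-resp d e)
  ⊩-resp (⊗ s d₁ d₂)  (⊗≈ e₁ e₂)    = ⊗ s (⊩-resp d₁ e₁) (⊩-resp d₂ e₂)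
  ⊩-resp (+ dist f)   (psum≈ _ _ es) = + dist (λ i → ⊩-resp (f i) (es i))
  ⊩-resp (lc L f d)   (lc≈ _ e es)  =
    lc L (λ i y y∉ → ⊩-resp (f i y y∉) (open-resp 0 (fvar y) (es i))) (⊩-resp d e)

  Fresh : Name → Term → Set
  Fresh x (bvar i)          = ⊤
  Fresh x (fvar y)          = y ≢ x
  Fresh x (lam t)           = Fresh x t
  Fresh x (app t s)         = Fresh x t × Fresh x s
  Fresh x (dm n ρ)          = ⊤
  Fresh x (U m V t)         = Fresh x t
  Fresh x (meas m t)        = Fresh x t
  Fresh x (_⊗_ t s)         = Fresh x t × Fresh x s
  Fresh x (psum k p ts)     = ∀ i → Fresh x (ts i)
  Fresh x (letcase° m r ts) = Fresh x r × (∀ i → Fresh x (ts i))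

  fresh-open : ∀ {x} k w t → Fresh x (openAt k w t) → Fresh x t
  fresh-open k w (bvar i)          _         = tt
  fresh-open k w (fvar y)          y≢x       = y≢x
  fresh-open k w (lam t)           h         = fresh-open (suc k) w t h
  fresh-open k w (app t s)         (h₁ , h₂) = fresh-open k w t h₁ , fresh-open k w s h₂
  fresh-open k w (dm n ρ)          _         = tt
  fresh-open k w (U m V t)         h         = fresh-open k w t h
  fresh-open k w (meas m t)        h         = fresh-open k w t h
  fresh-open k w (_⊗_ t s)         (h₁ , h₂) = fresh-open k w t h₁ , fresh-open k w s h₂
  fresh-open k w (psum j p ts)     h         = λ i → fresh-open k w (ts i) (h i)
  fresh-open k w (letcase° m r ts) (h₁ , h₂) =
    fresh-open k w r h₁ , λ i → fresh-open (suc k) w (ts i) (h₂ i)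

  fresh-subst : ∀ {x r} t → Fresh x t → t ≈ t [ r / x ]
  fresh-subst (bvar i)          _         = bvar≈ i
  fresh-subst {x} (fvar y)     y≢x with y ≟ x
  ... | yes y≡x = ⊥-elim (y≢x y≡x)
  ... | no _    = fvar≈ y
  fresh-subst (lam t)           h         = lam≈ (fresh-subst t h)
  fresh-subst (app t s)         (h₁ , h₂) = app≈ (fresh-subst t h₁) (fresh-subst s h₂)
  fresh-subst (dm n ρ)          _         = dm≈ n ρ
  fresh-subst (U m V t)         h         = U≈ m V (fresh-subst t h)
  fresh-subst (meas m t)        h         = meas≈ m (fresh-subst t h)
  fresh-subst (_⊗_ t s)         (h₁ , h₂) = ⊗≈ (fresh-subst t h₁) (fresh-subst s h₂)
  fresh-subst (psum k p ts)     h         = psum≈ k p (λ i → fresh-subst (ts i) (h i))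
  fresh-subst (letcase° m r ts) (h₁ , h₂) = lc≈ m (fresh-subst r h₁) (λ i → fresh-subst (ts i) (h₂ i))

  typed-fresh : ∀ {Θ t B x} → Θ ⊩ t ∶ B → x ∉ dom Θ → Fresh x t
  typed-fresh (ax _ z∈) x∉ refl = x∉ (declared z∈)
  typed-fresh {x = x} (⊸i {t = t} L f) x∉ =
    let (y , y∉) = fresh (x ∷ L)
    in fresh-open 0 (fvar y) t (typed-fresh (f y (y∉ ∘ there)) (∉-∷ (y∉ ∘ here) x∉))
  typed-fresh (⊸e s d₁ d₂) x∉ = typed-fresh d₁ (∉-⊆ (≅-⊆ˡ s) x∉) , typed-fresh d₂ (∉-⊆ (≅-⊆ʳ s) x∉)
  typed-fresh (ax-ρ _)     _  = tt
  typed-fresh (u d)        x∉ = typed-fresh d x∉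
  typed-fresh (π _ d)      x∉ = typed-fresh d x∉
  typed-fresh (⊗ s d₁ d₂)  x∉ = typed-fresh d₁ (∉-⊆ (≅-⊆ˡ s) x∉) , typed-fresh d₂ (∉-⊆ (≅-⊆ʳ s) x∉)
  typed-fresh (+ _ f)      x∉ = λ i → typed-fresh (f i) x∉
  typed-fresh {x = x} (lc {ts = ts} L f d) x∉ =
    typed-fresh d x∉ , λ i →
      let (y , y∉) = fresh (x ∷ L)
      in fresh-open 0 (fvar y) (ts i) (typed-fresh (f i y (y∉ ∘ there)) (∉-∷ (y∉ ∘ here) λ ()))

  Closed : ℕ → Term → Set
  Closed k (bvar i)          = i < k
  Closed k (fvar y)          = ⊤
  Closed k (lam t)           = Closed (suc k) t
  Closed k (app t s)         = Closed k t × Closed k s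
  Closed k (dm n ρ)          = ⊤
  Closed k (U m V t)         = Closed k t
  Closed k (meas m t)        = Closed k t
  Closed k (_⊗_ t s)         = Closed k t × Closed k s
  Closed k (psum j p ts)     = ∀ i → Closed k (ts i)
  Closed k (letcase° m r ts) = Closed k r × (∀ i → Closed (suc k) (ts i))

  closed-open : ∀ k w t → Closed k (openAt k w t) → Closed (suc k) t
  closed-open k w (bvar i) h with i ≟ k
  ... | yes refl = n<1+n i
  ... | no _     = m<n⇒m<1+n h
  closed-open k w (fvar y)          _         = tt
  closed-open k w (lam t)           h         = closed-open (suc k) w t h
  closed-open k w (app t s)         (h₁ , h₂) = closed-open k w t h₁ , closed-open k w s h₂
  closed-open k w (dm n ρ)          _         = tt
  closed-open k w (U m V t)         h         = closed-open k w t h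
  closed-open k w (meas m t)        h         = closed-open k w t h
  closed-open k w (_⊗_ t s)         (h₁ , h₂) = closed-open k w t h₁ , closed-open k w s h₂
  closed-open k w (psum j p ts)     h         = λ i → closed-open k w (ts i) (h i)
  closed-open k w (letcase° m r ts) (h₁ , h₂) =
    closed-open k w r h₁ , λ i → closed-open (suc k) w (ts i) (h₂ i)

  closed-open-id : ∀ {k j} w t → k ≤ j → Closed k t → t ≈ openAt j w t
  closed-open-id {j = j} w (bvar i) k≤j i<k with i ≟ j
  ... | yes refl = ⊥-elim (1+n≰n (≤-trans i<k k≤j))
  ... | no _     = bvar≈ i
  closed-open-id w (fvar y)          _   _         = fvar≈ y
  closed-open-id w (lam t)           k≤j h         = lam≈ (closed-open-id w t (s≤s k≤j) h)
  closed-open-id w (app t s)         k≤j (h₁ , h₂) =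
    app≈ (closed-open-id w t k≤j h₁) (closed-open-id w s k≤j h₂)
  closed-open-id w (dm n ρ)          _   _         = dm≈ n ρ
  closed-open-id w (U m V t)         k≤j h         = U≈ m V (closed-open-id w t k≤j h)
  closed-open-id w (meas m t)        k≤j h         = meas≈ m (closed-open-id w t k≤j h)
  closed-open-id w (_⊗_ t s)         k≤j (h₁ , h₂) =
    ⊗≈ (closed-open-id w t k≤j h₁) (closed-open-id w s k≤j h₂)
  closed-open-id w (psum l p ts)     k≤j h         =
    psum≈ l p (λ i → closed-open-id w (ts i) k≤j (h i))
  closed-open-id w (letcase° m r ts) k≤j (h₁ , h₂) =
    lc≈ m (closed-open-id w r k≤j h₁) (λ i → closed-open-id w (ts i) (s≤s k≤j) (h₂ i))

  typed-closed : ∀ {Γ t B} → Γ ⊩ t ∶ B → Closed 0 t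
  typed-closed (ax _ _) = tt
  typed-closed (⊸i {t = t} L f) =
    let (y , y∉) = fresh L in closed-open 0 (fvar y) t (typed-closed (f y y∉))
  typed-closed (⊸e _ d₁ d₂) = typed-closed d₁ , typed-closed d₂
  typed-closed (ax-ρ _)     = tt
  typed-closed (u d)        = typed-closed d
  typed-closed (π _ d)      = typed-closed d
  typed-closed (⊗ _ d₁ d₂)  = typed-closed d₁ , typed-closed d₂
  typed-closed (+ _ f)      = λ i → typed-closed (f i)
  typed-closed (lc {ts = ts} L f d) =
    typed-closed d , λ i →
      let (y , y∉) = fresh L in closed-open 0 (fvar y) (ts i) (typed-closed (f i y y∉))

  open-subst : ∀ {x y r} → Closed 0 r → y ≢ x → ∀ k t →
               openAt k (fvar y) t [ r / x ] ≈ openAt k (fvar y) (t [ r / x ])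
  open-subst {x} {y} _ y≢x k (bvar i) with i ≟ k
  ... | no _  = bvar≈ i
  ... | yes _ with y ≟ x
  ...   | yes y≡x = ⊥-elim (y≢x y≡x)
  ...   | no _    = fvar≈ y
  open-subst {x} {r = r} cl _ k (fvar z) with z ≟ x
  ... | yes _ = closed-open-id _ r z≤n cl
  ... | no _  = fvar≈ z
  open-subst cl y≢x k (lam t)           = lam≈ (open-subst cl y≢x (suc k) t)
  open-subst cl y≢x k (app t s)         = app≈ (open-subst cl y≢x k t) (open-subst cl y≢x k s)
  open-subst cl y≢x k (dm n ρ)          = dm≈ n ρ
  open-subst cl y≢x k (U m V t)         = U≈ m V (open-subst cl y≢x k t)
  open-subst cl y≢x k (meas m t)        = meas≈ m (open-subst cl y≢x k t)
  open-subst cl y≢x k (_⊗_ t s)         = ⊗≈ (open-subst cl y≢x k t) (open-subst cl y≢x k s)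
  open-subst cl y≢x k (psum j p ts)     = psum≈ j p (λ i → open-subst cl y≢x k (ts i))
  open-subst cl y≢x k (letcase° m r ts) =
    lc≈ m (open-subst cl y≢x k r) (λ i → open-subst cl y≢x (suc k) (ts i))

  weaken : ∀ {Θ E Γ t B} → Γ ⊩ t ∶ B → Θ ≅ E ,, Γ → Θ ⊩ t ∶ B
  weaken (ax _ x∈) w = ax (proj₁ w) (≅-⊆ʳ w x∈)
  weaken {Θ} {E} {Γ} (⊸i L f) w =
    ⊸i (L ++ dom Θ) λ y y∉ → weaken (f y (y∉ ∘ ∈-++⁺ˡ)) (≅-∷ʳ {Γ = E} {Γ} (y∉ ∘ ∈-++⁺ʳ L) w)
  weaken {E = E} (⊸e {Γ = Γ₁} s d₁ d₂) w =
    ⊸e (≅-assoc w s) (weaken d₁ (≅-okˡ {Γ = E ++ Γ₁} (≅-assoc w s) , ↭-refl)) d₂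
  weaken (ax-ρ _) w = ax-ρ (proj₁ w)
  weaken (u d)    w = u (weaken d w)
  weaken (π p d)  w = π p (weaken d w)
  weaken {E = E} (⊗ {Γ = Γ₁} s d₁ d₂) w =
    ⊗ (≅-assoc w s) (weaken d₁ (≅-okˡ {Γ = E ++ Γ₁} (≅-assoc w s) , ↭-refl)) d₂
  weaken (+ dist f)  w = + dist (λ i → weaken (f i) w)
  weaken (lc L f d) w = lc L f (weaken d w)

  subst-absent : ∀ {Γ t B x r} → Γ ⊩ t ∶ B → x ∉ dom Γ → Γ ⊩ t [ r / x ] ∶ B
  subst-absent {t = t} d x∉ = ⊩-resp d (fresh-subst t (typed-fresh d x∉))

  data Premises (Ξ : Ctx) (t₁ t₂ : Term) (B₁ B₂ : Ty) : Set where
    premises : ∀ {Ξ₁ Ξ₂} → Ξ ≅ Ξ₁ ,, Ξ₂ → Ξ₁ ⊩ t₁ ∶ B₁ → Ξ₂ ⊩ t₂ ∶ B₂ → Premises Ξ t₁ t₂ B₁ B₂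

  substitution : ∀ {Θ Γ Δ x A B t r} → Θ ⊩ t ∶ B → Θ ↭ (x , A) ∷ Γ → Δ ⊩ r ∶ A →
                 Ok (Γ ++ Δ) → (Γ ++ Δ) ⊩ t [ r / x ] ∶ B
  subst-premises : ∀ {Θ Θ₁ Θ₂ Γ Δ x A B₁ B₂ t₁ t₂ r} → Θ ≅ Θ₁ ,, Θ₂ →
                   Θ₁ ⊩ t₁ ∶ B₁ → Θ₂ ⊩ t₂ ∶ B₂ → Θ ↭ (x , A) ∷ Γ → Δ ⊩ r ∶ A →
                   Ok (Γ ++ Δ) → Premises (Γ ++ Δ) (t₁ [ r / x ]) (t₂ [ r / x ]) B₁ B₂

  substitution {Γ = Γ} {Δ} {x} (ax {x = z} okΘ z∈) Θ↭ dr ok with z ≟ x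
  ... | yes refl = subst (λ C → (Γ ++ Δ) ⊩ _ ∶ C)
                         (Ok-unique okΘ (∈-resp-↭ (↭-sym Θ↭) (here refl)) z∈)
                         (weaken dr (ok , ↭-refl))
  ... | no z≢x   = ax ok (∈-++⁺ˡ (∈-others Θ↭ z∈ z≢x))
  substitution {Γ = Γ} {Δ} {x} (⊸i {t = t} {A = A'} L f) Θ↭ dr ok =
    ⊸i (x ∷ L ++ dom (Γ ++ Δ)) λ y y∉ →
      ⊩-resp (substitution (f y (y∉ ∘ there ∘ ∈-++⁺ˡ))
                           (↭-trans (↭-prep _ Θ↭) (↭-swap _ _ ↭-refl)) dr
                           (Ok-∷ {A = A'} (y∉ ∘ there ∘ ∈-++⁺ʳ L) ok))
             (open-subst (typed-closed dr) (y∉ ∘ here) 0 t)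
  substitution (⊸e s d₁ d₂) Θ↭ dr ok with subst-premises s d₁ d₂ Θ↭ dr ok
  ... | premises s' d₁' d₂' = ⊸e s' d₁' d₂'
  substitution (ax-ρ _) _  _  ok = ax-ρ ok
  substitution (u d)    Θ↭ dr ok = u (substitution d Θ↭ dr ok)
  substitution (π p d)  Θ↭ dr ok = π p (substitution d Θ↭ dr ok)
  substitution (⊗ s d₁ d₂) Θ↭ dr ok with subst-premises s d₁ d₂ Θ↭ dr ok
  ... | premises s' d₁' d₂' = ⊗ s' d₁' d₂'
  substitution (+ dist f) Θ↭ dr ok = + dist (λ i → substitution (f i) Θ↭ dr ok)
  substitution {x = x} (lc {ts = ts} L f d) Θ↭ dr ok =
    lc (x ∷ L) (λ i y y∉ → ⊩-resp (subst-absent (f i y (y∉ ∘ there)) (∉-∷ (y∉ ∘ here) λ ()))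
                                  (open-subst (typed-closed dr) (y∉ ∘ here) 0 (ts i)))
       (substitution d Θ↭ dr ok)

  subst-premises s d₁ d₂ Θ↭ dr ok with locate s Θ↭ ok
  ... | inj₁ F = let open Focus F in
    premises joined
             (substitution d₁ dropx dr (≅-okˡ {Γ = rest ++ _} joined))
             (subst-absent d₂ absent)
  ... | inj₂ F = let open Focus F in
    premises (≅-comm {Γ = rest ++ _} joined)
             (subst-absent d₁ absent)
             (substitution d₂ dropx dr (≅-okˡ {Γ = rest ++ _} joined))

lemma8 : (𝔸 : Annot) →
    (let open Lρ 𝔸 in
      ∀ {Γ Δ x A B} {t r : Term} →
        ((x , A) ∷ Γ) ⊢ t ∶ B → Δ ⊢ r ∶ A → Ok (Γ ++ Δ) →
        (Γ ++ Δ) ⊢ t [ r / x ] ∶ B)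
    ×
    (let open Lρ° 𝔸 in
      ∀ {Γ Δ x A B} {t r : Term} →
        ((x , A) ∷ Γ) ⊩ t ∶ B → Δ ⊩ r ∶ A → Ok (Γ ++ Δ) →
        (Γ ++ Δ) ⊩ t [ r / x ] ∶ B)
lemma8 𝔸 = (λ d dr ok → TypingLρ.substitution 𝔸 d ↭-refl dr ok)
         , (λ d dr ok → TypingLρ°.substitution 𝔸 d ↭-refl dr ok)
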